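{- Let $G=(V,E)$ be a finite simple graph with $E\neq\emptyset$ that is not the disjoint union of a complete bipartite graph and an empty (edgeless) graph. Then \[ \sum_{F\subseteq E}(-1)^{|F|} N(G-F,x) = 0. \]
   Context: $G-F$ denotes the graph $(V,E\setminus F)$ (same vertex set, edges of $F$ removed). For a graph $H=(V,E')$, the neighborhood complex is $\mathcal{N}(H)=\{X\subseteq V \mid \exists v\in V: X\subseteq N_H(v)\}$, where $N_H(v)$ is the set of vertices adjacent to $v$ in $H$, and the neighborhood polynomial is $N(H,x)=\sum_{W\in\mathcal{N}(H)}x^{|W|}$. -}

module Defs where

open import Data.Nat using (ℕ; zero; suc; _<ᵇ_)
open import Data.Nat.Properties using (_≟_)
open import Data.Bool using (Bool; true; false; _∧_; _∨_; not)
open import Data.Bool.Properties using (∨-comm)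
open import Data.Fin using (Fin; toℕ)
import Data.Fin.Properties as FinP
open import Data.Fin.Subset using (Subset; inside; outside; _⊆_; _∈_; ∣_∣)
open import Data.Fin.Subset.Properties using (_⊆?_)
open import Data.List using (List; []; _∷_; _++_; map; length; filter; filterᵇ; cartesianProduct; allFin; foldr)
open import Data.Vec using (Vec; tabulate; []; _∷_)
open import Data.Product using (_×_; _,_; ∃; ∃-syntax; proj₁; proj₂)
open import Data.Sum using (_⊎_)
open import Data.Integer using (ℤ; +_; -[1+_]; _^_) renaming (_+_ to _+ℤ_; _*_ to _*ℤ_)
open import Relation.Nullary using (Dec; yes; no; ¬_)
open import Relation.Nullary.Decidable using (_×-dec_; ⌊_⌋)
open import Relation.Binary.PropositionalEquality using (_≡_; refl; cong)
open import Function using (_⇔_)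

record Graph (n : ℕ) : Set where
  field
    adj    : Fin n → Fin n → Bool
    sym    : ∀ i j → adj i j ≡ adj j i
    irrefl : ∀ i → adj i i ≡ false
open Graph public

-- Edges are unordered pairs {i,j}; represented as (i , j) with i < j.
Edge : ℕ → Set
Edge n = Fin n × Fin n

edges : ∀ {n} → Graph n → List (Edge n)
edges {n} G = filterᵇ (λ e → (toℕ (proj₁ e) <ᵇ toℕ (proj₂ e)) ∧ adj G (proj₁ e) (proj₂ e))
                      (cartesianProduct (allFin n) (allFin n))

_≟F_ : ∀ {n} → Fin n → Fin n → Bool
i ≟F j = ⌊ i FinP.≟ j ⌋

hitsEdge : ∀ {n} → Edge n → Fin n → Fin n → Bool
hitsEdge e i j = ((proj₁ e ≟F i) ∧ (proj₂ e ≟F j)) ∨ ((proj₁ e ≟F j) ∧ (proj₂ e ≟F i))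

memEdge : ∀ {n} → List (Edge n) → Fin n → Fin n → Bool
memEdge [] i j = false
memEdge (e ∷ F) i j = hitsEdge e i j ∨ memEdge F i j

memEdge-sym : ∀ {n} (F : List (Edge n)) i j → memEdge F i j ≡ memEdge F j i
memEdge-sym [] i j = refl
memEdge-sym (e ∷ F) i j
  rewrite ∨-comm ((proj₁ e ≟F i) ∧ (proj₂ e ≟F j)) ((proj₁ e ≟F j) ∧ (proj₂ e ≟F i))
        | memEdge-sym F i j = refl

_─E_ : ∀ {n} → Graph n → List (Edge n) → Graph n
adj    (G ─E F) i j = adj G i j ∧ not (memEdge F i j)
sym    (G ─E F) i j rewrite sym G i j | memEdge-sym F i j = refl
irrefl (G ─E F) i rewrite irrefl G i = refl

subLists : ∀ {A : Set} → List A → List (List A)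
subLists [] = [] ∷ []
subLists (x ∷ xs) = subLists xs ++ map (x ∷_) (subLists xs)

allSubsets : ∀ n → List (Subset n)
allSubsets zero = [] ∷ []
allSubsets (suc n) = map (outside ∷_) (allSubsets n) ++ map (inside ∷_) (allSubsets n)

nbhd : ∀ {n} → Graph n → Fin n → Subset n
nbhd H v = tabulate (λ u → adj H v u)

InNbhdComplex : ∀ {n} → Graph n → Subset n → Set
InNbhdComplex H X = ∃[ v ] (X ⊆ nbhd H v)

inNbhdComplex? : ∀ {n} (H : Graph n) (X : Subset n) → Dec (InNbhdComplex H X)
inNbhdComplex? H X = FinP.any? (λ v → X ⊆? nbhd H v)

-- Coefficient of x^k in the neighbourhood polynomial N(H,x):
-- the number of W ∈ 𝒩(H) with |W| = k.
nbhdPolyCoeff : ∀ {n} → Graph n → ℕ → ℕ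
nbhdPolyCoeff {n} H k =
  length (filter (λ X → inNbhdComplex? H X ×-dec (∣ X ∣ ≟ k)) (allSubsets n))

-- Coefficient of x^k in  Σ_{F ⊆ E} (-1)^{|F|} N(G - F, x)   (an integer).
altSumCoeff : ∀ {n} → Graph n → ℕ → ℤ
altSumCoeff G k =
  foldr (λ F acc → ((-[1+ 0 ] ^ length F) *ℤ (+ nbhdPolyCoeff (G ─E F) k)) +ℤ acc)
        (+ 0) (subLists (edges G))

IsCompleteBipartitePlusEmpty : ∀ {n} → Graph n → Set
IsCompleteBipartitePlusEmpty {n} G =
  ∃[ A ] ∃[ B ] ((∀ (v : Fin n) → v ∈ A → ¬ (v ∈ B)) ×
     (∀ (i j : Fin n) → (adj G i j ≡ true) ⇔ ((i ∈ A × j ∈ B) ⊎ (i ∈ B × j ∈ A))))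

HasEdge : ∀ {n} → Graph n → Set
HasEdge {n} G = ∃[ i ] ∃[ j ] (adj G i j ≡ true)

module Submission where

-- Idea of the proof.  Write the coefficient of x^k as a double sum and swap it:
--
--   Σ_{F ⊆ E} (-1)^{|F|} #{X ∈ 𝒩(G-F) : |X| = k}
--     = Σ_{|X| = k} Σ_{F ⊆ E} (-1)^{|F|} [X ∈ 𝒩(G-F)].
--
-- Fix X and call a vertex v a dominator if X ⊆ N_G(v).  An edge {u,w} is
-- critical for X if one endpoint dominates X while the other lies in X.
-- Deleting a non-critical edge e never changes whether X ∈ 𝒩(G-F), so
-- F ↦ F △ {e} is a sign-reversing involution and the inner sum vanishes.
-- If on the other hand every edge is critical, then G is the complete
-- bipartite graph between the dominators and X plus isolated vertices,
-- which the hypothesis excludes.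

open import Defs hiding (sym)
open import Data.Nat using (ℕ; _<_; _<ᵇ_)
import Data.Nat.Properties as ℕP
open import Data.Integer using (ℤ; +_; -[1+_]; _+_; _*_; -_; _-_; _^_)
import Data.Integer.Properties as ℤP
import Algebra.Properties.CommutativeSemigroup as CommSemigroupProps
open import Data.Bool using (Bool; true; false; _∧_; _∨_; not)
open import Data.Bool.Properties using (T?; T-≡; T-∧; ∧-conicalˡ; ∧-conicalʳ; ∧-identityʳ; ∧-zeroʳ; ∨-commutativeMonoid)
open import Algebra.Bundles using (CommutativeMonoid)
open import Data.Empty using (⊥-elim)
open import Data.Fin using (Fin; toℕ)
import Data.Fin.Properties as FinP
open import Data.Fin.Subset using (Subset; _⊆_; _∈_; ∣_∣)
open import Data.Fin.Subset.Properties using (_⊆?_; _∈?_)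
open import Data.List using (List; []; _∷_; _++_; map; length; filter; foldr)
open import Data.List.Relation.Unary.All using (All; all?)
import Data.List.Relation.Unary.All as All
open import Data.List.Relation.Unary.All.Properties using (¬All⇒Any¬)
import Data.List.Membership.Propositional as List
open import Data.List.Membership.Propositional.Properties using (∈-∃++; ∈-filter⁺; ∈-cartesianProduct⁺; ∈-allFin)
open import Data.Vec using (tabulate)
open import Data.Vec.Properties using (tabulate-cong; lookup∘tabulate; []=⇒lookup; lookup⇒[]=)
open import Data.Product using (_×_; _,_)
open import Data.Sum using (_⊎_; inj₁; inj₂)
import Data.Sum as Sum
open import Relation.Nullary using (¬_; Dec; yes; no; does)
open import Relation.Nullary.Decidable using (does-⇔; _×-dec_; _⊎-dec_)
open import Relation.Unary using (Decidable)
open import Relation.Binary using (tri<; tri≈; tri>)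
open import Relation.Binary.PropositionalEquality using (_≡_; refl; sym; trans; cong; cong₂; subst; module ≡-Reasoning)
open import Function using (_⇔_; _∘_; Equivalence)
open import Function.Bundles using (mk⇔)

open Equivalence using (from)

∑ : {A : Set} → List A → (A → ℤ) → ℤ
∑ []       f = + 0
∑ (x ∷ xs) f = f x + ∑ xs f

syntax ∑ xs (λ x → f) = ∑[ x ← xs ] f

foldr-as-∑ : {A : Set} (xs : List A) (f : A → ℤ) → foldr (λ x acc → f x + acc) (+ 0) xs ≡ ∑ xs f
foldr-as-∑ []       f = refl
foldr-as-∑ (x ∷ xs) f = cong (_+_ (f x)) (foldr-as-∑ xs f)

∑-++ : {A : Set} (xs ys : List A) (f : A → ℤ) → ∑ (xs ++ ys) f ≡ ∑ xs f + ∑ ys f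
∑-++ []       ys f = sym (ℤP.+-identityˡ _)
∑-++ (x ∷ xs) ys f = trans (cong (_+_ (f x)) (∑-++ xs ys f)) (sym (ℤP.+-assoc (f x) _ _))

∑-map : {A B : Set} (g : A → B) (xs : List A) (f : B → ℤ) → ∑ (map g xs) f ≡ ∑ xs (f ∘ g)
∑-map g []       f = refl
∑-map g (x ∷ xs) f = cong (_+_ (f (g x))) (∑-map g xs f)

∑-cong : {A : Set} (xs : List A) {f g : A → ℤ} → (∀ x → f x ≡ g x) → ∑ xs f ≡ ∑ xs g
∑-cong []       f≗g = refl
∑-cong (x ∷ xs) f≗g = cong₂ _+_ (f≗g x) (∑-cong xs f≗g)

∑-zero : {A : Set} (xs : List A) {f : A → ℤ} → (∀ x → f x ≡ + 0) → ∑ xs f ≡ + 0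
∑-zero []       f≗0 = refl
∑-zero (x ∷ xs) f≗0 = cong₂ _+_ (f≗0 x) (∑-zero xs f≗0)

∑-*ˡ : {A : Set} (xs : List A) (c : ℤ) (f : A → ℤ) → ∑[ x ← xs ] (c * f x) ≡ c * ∑ xs f
∑-*ˡ []       c f = sym (ℤP.*-zeroʳ c)
∑-*ˡ (x ∷ xs) c f = trans (cong (_+_ (c * f x)) (∑-*ˡ xs c f)) (sym (ℤP.*-distribˡ-+ c (f x) _))

∑-+ : {A : Set} (xs : List A) (f g : A → ℤ) → ∑[ x ← xs ] (f x + g x) ≡ ∑ xs f + ∑ xs g
∑-+ []       f g = refl
∑-+ (x ∷ xs) f g = trans (cong (_+_ (f x + g x)) (∑-+ xs f g))
  (CommSemigroupProps.interchange ℤP.+-commutativeSemigroup (f x) (g x) _ _)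

∑-comm : {A B : Set} (xs : List A) (ys : List B) (h : A → B → ℤ) →
  ∑[ a ← xs ] ∑[ b ← ys ] h a b ≡ ∑[ b ← ys ] ∑[ a ← xs ] h a b
∑-comm []       ys h = sym (∑-zero ys (λ _ → refl))
∑-comm (x ∷ xs) ys h =
  trans (cong (_+_ (∑ ys (h x))) (∑-comm xs ys h)) (sym (∑-+ ys (h x) (λ b → ∑[ a ← xs ] h a b)))

𝟙 : Bool → ℤ
𝟙 true  = + 1
𝟙 false = + 0

count-as-∑ : {A : Set} {P : A → Set} (P? : Decidable P) (xs : List A) →
  + length (filter P? xs) ≡ ∑[ x ← xs ] 𝟙 (does (P? x))
count-as-∑ P? []       = refl
count-as-∑ P? (x ∷ xs) with P? x
... | yes _ = cong (_+_ (+ 1)) (count-as-∑ P? xs)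
... | no  _ = trans (count-as-∑ P? xs) (sym (ℤP.+-identityˡ _))

sgn : {A : Set} → List A → ℤ
sgn F = -[1+ 0 ] ^ length F

alternatingSum : {A : Set} → List A → (List A → ℤ) → ℤ
alternatingSum L q = ∑[ F ← subLists L ] (sgn F * q F)

-- Splitting the subsets of x ∷ L according to whether they contain x.
alternatingSum-∷ : {A : Set} (x : A) (L : List A) (q : List A → ℤ) →
  alternatingSum (x ∷ L) q ≡ alternatingSum L q - alternatingSum L (q ∘ (x ∷_))
alternatingSum-∷ x L q = begin
  alternatingSum (x ∷ L) q
    ≡⟨ ∑-++ (subLists L) _ _ ⟩
  alternatingSum L q + ∑[ F ← map (x ∷_) (subLists L) ] (sgn F * q F)
    ≡⟨ cong (_+_ (alternatingSum L q)) (begin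
        ∑[ F ← map (x ∷_) (subLists L) ] (sgn F * q F)
          ≡⟨ ∑-map (x ∷_) (subLists L) _ ⟩
        ∑[ F ← subLists L ] (-[1+ 0 ] * sgn F * q (x ∷ F))
          ≡⟨ ∑-cong (subLists L) (λ F → ℤP.*-assoc -[1+ 0 ] (sgn F) _) ⟩
        ∑[ F ← subLists L ] (-[1+ 0 ] * (sgn F * q (x ∷ F)))
          ≡⟨ ∑-*ˡ (subLists L) -[1+ 0 ] _ ⟩
        -[1+ 0 ] * alternatingSum L (q ∘ (x ∷_))
          ≡⟨ ℤP.-1*i≡-i _ ⟩
        - alternatingSum L (q ∘ (x ∷_)) ∎) ⟩
  alternatingSum L q - alternatingSum L (q ∘ (x ∷_)) ∎
  where open ≡-Reasoning

alternatingSum-absorbed : {A : Set} (e : A) (L : List A) (q : List A → ℤ) →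
  (∀ F → q (e ∷ F) ≡ q F) → alternatingSum (e ∷ L) q ≡ + 0
alternatingSum-absorbed e L q absorbs =
  trans (alternatingSum-∷ e L q)
    (trans (cong (λ s → alternatingSum L q - s) (∑-cong (subLists L) (λ F → cong (sgn F *_) (absorbs F))))
           (ℤP.+-inverseʳ (alternatingSum L q)))

Reorderable : {A : Set} → (List A → ℤ) → Set
Reorderable {A} q = ∀ (pre : List A) x y F → q (pre ++ x ∷ y ∷ F) ≡ q (pre ++ y ∷ x ∷ F)

alternatingSum-vanishes : {A : Set} {e : A} {L : List A} (q : List A → ℤ) → e List.∈ L →
  Reorderable q → (∀ F → q (e ∷ F) ≡ q F) → alternatingSum L q ≡ + 0
alternatingSum-vanishes {A} {e} q e∈L reorderable absorbs
  with pre , post , refl ← ∈-∃++ e∈L = vanish pre q reorderable absorbs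
  where
  vanish : ∀ pre (q : List A → ℤ) → Reorderable q → (∀ F → q (e ∷ F) ≡ q F) →
    alternatingSum (pre ++ e ∷ post) q ≡ + 0
  vanish []        q _           absorbs = alternatingSum-absorbed e post q absorbs
  vanish (x ∷ pre) q reorderable absorbs =
    trans (alternatingSum-∷ x (pre ++ e ∷ post) q)
      (cong₂ _-_ (vanish pre q reorderable absorbs)
                 (vanish pre (q ∘ (x ∷_)) (λ pre′ → reorderable (x ∷ pre′)) absorbs′))
    where
    -- adding e commutes past the extra x
    absorbs′ : ∀ F → q (x ∷ e ∷ F) ≡ q (x ∷ F)
    absorbs′ F = trans (reorderable [] x e F) (absorbs (x ∷ F))

∈-tabulate⁺ : ∀ {n} (f : Fin n → Bool) {x} → f x ≡ true → x ∈ tabulate f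
∈-tabulate⁺ f {x} fx = lookup⇒[]= x (tabulate f) (trans (lookup∘tabulate f x) fx)

∈-tabulate⁻ : ∀ {n} (f : Fin n → Bool) {x} → x ∈ tabulate f → f x ≡ true
∈-tabulate⁻ f {x} x∈ = trans (sym (lookup∘tabulate f x)) ([]=⇒lookup x∈)

memEdge-reorder : ∀ {n} (pre : List (Edge n)) x y F i j →
  memEdge (pre ++ x ∷ y ∷ F) i j ≡ memEdge (pre ++ y ∷ x ∷ F) i j
memEdge-reorder []        x y F i j =
  CommSemigroupProps.x∙yz≈y∙xz (CommutativeMonoid.commutativeSemigroup ∨-commutativeMonoid)
    (hitsEdge x i j) (hitsEdge y i j) _
memEdge-reorder (z ∷ pre) x y F i j = cong (hitsEdge z i j ∨_) (memEdge-reorder pre x y F i j)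

≟F-sound : ∀ {n} {i j : Fin n} → (i ≟F j) ≡ true → i ≡ j
≟F-sound {i = i} {j} i≟j with i FinP.≟ j
... | yes i≡j = i≡j
≟F-sound () | no _

hitsEdge-sound : ∀ {n} (e : Edge n) {v x} → hitsEdge e v x ≡ true → e ≡ (v , x) ⊎ e ≡ (x , v)
hitsEdge-sound (u , w) {v} {x} hit with (u ≟F v) ∧ (w ≟F x) in forward
... | true  = inj₁ (cong₂ _,_ (≟F-sound (∧-conicalˡ _ _ forward)) (≟F-sound (∧-conicalʳ _ _ forward)))
... | false = inj₂ (cong₂ _,_ (≟F-sound (∧-conicalˡ _ _ hit)) (≟F-sound (∧-conicalʳ _ _ hit)))

module _ {n : ℕ} (G : Graph n) where

  adj-─E-∷ : ∀ e F v x → adj (G ─E (e ∷ F)) v x ≡ adj (G ─E F) v x ∧ not (hitsEdge e v x)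
  adj-─E-∷ e F v x with adj G v x | hitsEdge e v x
  ... | true  | true  = sym (∧-zeroʳ _)
  ... | true  | false = sym (∧-identityʳ _)
  ... | false | _     = refl

  InNbhdComplex-reorder : ∀ X pre x y F →
    InNbhdComplex (G ─E (pre ++ x ∷ y ∷ F)) X → InNbhdComplex (G ─E (pre ++ y ∷ x ∷ F)) X
  InNbhdComplex-reorder X pre x y F (v , X⊆N) = v , subst (X ⊆_) same-nbhd X⊆N
    where
    same-nbhd : nbhd (G ─E (pre ++ x ∷ y ∷ F)) v ≡ nbhd (G ─E (pre ++ y ∷ x ∷ F)) v
    same-nbhd = tabulate-cong (λ u → cong (λ b → adj G v u ∧ not b) (memEdge-reorder pre x y F v u))

  ∈edges : ∀ {i j} → toℕ i < toℕ j → adj G i j ≡ true → (i , j) List.∈ edges G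
  ∈edges {i} {j} i<j ij = ∈-filter⁺ (T? ∘ listed) (∈-cartesianProduct⁺ (∈-allFin i) (∈-allFin j))
                                   (from T-∧ (ℕP.<⇒<ᵇ i<j , from T-≡ ij))
    where
    listed : Edge n → Bool
    listed (u , w) = (toℕ u <ᵇ toℕ w) ∧ adj G u w

  module _ (X : Subset n) where

    Dominates : Fin n → Set
    Dominates v = X ⊆ nbhd G v

    -- An edge is critical for X if one endpoint dominates X and the other
    -- lies in X; only such edges can decide whether X ∈ 𝒩(G - F).
    Critical : Edge n → Set
    Critical (u , w) = (Dominates u × w ∈ X) ⊎ (Dominates w × u ∈ X)

    critical? : Decidable Critical
    critical? (u , w) = ((X ⊆? nbhd G u) ×-dec (w ∈? X)) ⊎-dec ((X ⊆? nbhd G w) ×-dec (u ∈? X))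

    noncritical-irrelevant : ∀ e F → ¬ Critical e →
      InNbhdComplex (G ─E (e ∷ F)) X ⇔ InNbhdComplex (G ─E F) X
    noncritical-irrelevant e F noncritical = mk⇔ shrink grow
      where
      shrink : InNbhdComplex (G ─E (e ∷ F)) X → InNbhdComplex (G ─E F) X
      shrink (v , X⊆N) = v , λ x∈X →
        ∈-tabulate⁺ _ (∧-conicalˡ _ _ (trans (sym (adj-─E-∷ e F v _)) (∈-tabulate⁻ _ (X⊆N x∈X))))

      grow : InNbhdComplex (G ─E F) X → InNbhdComplex (G ─E (e ∷ F)) X
      grow (v , X⊆N) = v , λ {x} x∈X → ∈-tabulate⁺ _ (begin
          adj (G ─E (e ∷ F)) v x                   ≡⟨ adj-─E-∷ e F v x ⟩
          adj (G ─E F) v x ∧ not (hitsEdge e v x)  ≡⟨ cong (λ b → adj (G ─E F) v x ∧ not b) (misses x∈X) ⟩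
          adj (G ─E F) v x ∧ true                  ≡⟨ ∧-identityʳ _ ⟩
          adj (G ─E F) v x                         ≡⟨ ∈-tabulate⁻ _ (X⊆N x∈X) ⟩
          true                                     ∎)
        where
        open ≡-Reasoning
        -- v dominates X already in G, as G - F is a subgraph of G
        dominates : Dominates v
        dominates x∈X = ∈-tabulate⁺ _ (∧-conicalˡ _ _ (∈-tabulate⁻ _ (X⊆N x∈X)))
        -- hence the non-critical edge e cannot join v to a vertex of X
        misses : ∀ {x} → x ∈ X → hitsEdge e v x ≡ false
        misses {x} x∈X with hitsEdge e v x in hit
        ... | false = refl
        ... | true with hitsEdge-sound e hit
        ...   | inj₁ refl = ⊥-elim (noncritical (inj₁ (dominates , x∈X)))
        ...   | inj₂ refl = ⊥-elim (noncritical (inj₂ (dominates , x∈X)))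

    dominators : Subset n
    dominators = tabulate (λ v → does (X ⊆? nbhd G v))

    ∈dominators⁺ : ∀ {v} → Dominates v → v ∈ dominators
    ∈dominators⁺ {v} dom with X ⊆? nbhd G v in dec
    ... | yes _   = ∈-tabulate⁺ _ (cong does dec)
    ... | no ¬dom = ⊥-elim (¬dom dom)

    ∈dominators⁻ : ∀ {v} → v ∈ dominators → Dominates v
    ∈dominators⁻ {v} v∈D with X ⊆? nbhd G v | ∈-tabulate⁻ _ v∈D
    ... | yes dom | _  = dom
    ... | no _    | ()

    adjacent⇒critical : All Critical (edges G) → ∀ i j → adj G i j ≡ true → Critical (i , j)
    adjacent⇒critical allCritical i j ij with ℕP.<-cmp (toℕ i) (toℕ j)
    ... | tri< i<j _ _ = All.lookup allCritical (∈edges i<j ij)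
    ... | tri≈ _ i≡j _ with refl ← FinP.toℕ-injective i≡j
                       with () ← trans (sym (irrefl G i)) ij
    ... | tri> _ _ j<i = Sum.swap (All.lookup allCritical (∈edges j<i (trans (Graph.sym G j i) ij)))

    allCritical⇒completeBipartite : All Critical (edges G) → IsCompleteBipartitePlusEmpty G
    allCritical⇒completeBipartite allCritical =
      dominators , X , disjoint , λ i j → mk⇔ (sides i j) (adjacent i j)
      where
      disjoint : ∀ v → v ∈ dominators → ¬ (v ∈ X)
      disjoint v v∈D v∈X with () ← trans (sym (irrefl G v)) (∈-tabulate⁻ _ (∈dominators⁻ v∈D v∈X))

      sides : ∀ i j → adj G i j ≡ true → (i ∈ dominators × j ∈ X) ⊎ (i ∈ X × j ∈ dominators)
      sides i j ij with adjacent⇒critical allCritical i j ij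
      ... | inj₁ (i-dom , j∈X) = inj₁ (∈dominators⁺ i-dom , j∈X)
      ... | inj₂ (j-dom , i∈X) = inj₂ (i∈X , ∈dominators⁺ j-dom)

      adjacent : ∀ i j → (i ∈ dominators × j ∈ X) ⊎ (i ∈ X × j ∈ dominators) → adj G i j ≡ true
      adjacent i j (inj₁ (i∈D , j∈X)) = ∈-tabulate⁻ _ (∈dominators⁻ i∈D j∈X)
      adjacent i j (inj₂ (i∈X , j∈D)) = trans (Graph.sym G i j) (∈-tabulate⁻ _ (∈dominators⁻ j∈D i∈X))

    -- For fixed X (and any extra Boolean condition c, such as |X| = k),
    -- Σ_{F ⊆ E} (-1)^{|F|} [X ∈ 𝒩(G - F) ∧ c] = 0 unless G is complete
    -- bipartite plus isolated vertices.
    alternatingSum-nbhd : ¬ IsCompleteBipartitePlusEmpty G → (c : Bool) →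
      alternatingSum (edges G) (λ F → 𝟙 (does (inNbhdComplex? (G ─E F) X) ∧ c)) ≡ + 0
    alternatingSum-nbhd notCB c with all? critical? (edges G)
    ... | yes allCritical = ⊥-elim (notCB (allCritical⇒completeBipartite allCritical))
    ... | no notAll with e , e∈E , noncritical ← List.find (¬All⇒Any¬ critical? (edges G) notAll) =
      alternatingSum-vanishes _ e∈E
        (λ pre x y F → indicator-cong (pre ++ x ∷ y ∷ F) (pre ++ y ∷ x ∷ F)
           (mk⇔ (InNbhdComplex-reorder X pre x y F) (InNbhdComplex-reorder X pre y x F)))
        (λ F → indicator-cong (e ∷ F) F (noncritical-irrelevant e F noncritical))
      where
      indicator-cong : ∀ F F′ → InNbhdComplex (G ─E F) X ⇔ InNbhdComplex (G ─E F′) X →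
        𝟙 (does (inNbhdComplex? (G ─E F) X) ∧ c) ≡ 𝟙 (does (inNbhdComplex? (G ─E F′) X) ∧ c)
      indicator-cong F F′ same = cong (λ b → 𝟙 (b ∧ c))
        (does-⇔ same (inNbhdComplex? (G ─E F) X) (inNbhdComplex? (G ─E F′) X))

mainTheorem3 : ∀ (n : ℕ) (G : Graph n) → HasEdge G → ¬ IsCompleteBipartitePlusEmpty G →
    ∀ (k : ℕ) → altSumCoeff G k ≡ + 0
mainTheorem3 n G _ notCB k = begin
  altSumCoeff G k
    ≡⟨ foldr-as-∑ (subLists (edges G)) _ ⟩
  ∑[ F ← subLists (edges G) ] (sgn F * + nbhdPolyCoeff (G ─E F) k)
    ≡⟨ ∑-cong (subLists (edges G)) (λ F → cong (sgn F *_) (count-as-∑ (isNbhd F) (allSubsets n))) ⟩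
  ∑[ F ← subLists (edges G) ] (sgn F * ∑[ X ← allSubsets n ] 𝟙 (does (isNbhd F X)))
    ≡⟨ ∑-cong (subLists (edges G)) (λ F → sym (∑-*ˡ (allSubsets n) (sgn F) _)) ⟩
  ∑[ F ← subLists (edges G) ] ∑[ X ← allSubsets n ] (sgn F * 𝟙 (does (isNbhd F X)))
    ≡⟨ ∑-comm (subLists (edges G)) (allSubsets n) _ ⟩
  ∑[ X ← allSubsets n ] alternatingSum (edges G) (λ F → 𝟙 (does (isNbhd F X)))
    ≡⟨ ∑-zero (allSubsets n) (λ X → alternatingSum-nbhd G X notCB _) ⟩
  + 0 ∎
  where
  open ≡-Reasoning
  isNbhd : (F : List (Edge n)) (X : Subset n) → Dec (InNbhdComplex (G ─E F) X × ∣ X ∣ ≡ k)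
  isNbhd F X = inNbhdComplex? (G ─E F) X ×-dec (∣ X ∣ ℕP.≟ k)
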